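{- Let $A=A_1\sqcup A_2\sqcup\cdots\sqcup A_t$ be a dyadic partition of a finite set $A$, and for $a\in A$ let $i(a)$ be the unique index with $a\in A_{i(a)}$. For every positive integer $s<t/2$ and every two-colouring $\beta:[t]\to\{L,R\}$, there exists $X\in\{L,R\}$ such that for every $I\subseteq[t]$ with $|I|=s-1$, \[ \bigl|\{a\in A : i(a)\notin I,\ \beta(i(a))=X\}\bigr|\ \ge\ \left\lfloor\frac{|A|}{2^{2s-1}}\right\rfloor. \]
   Context: A dyadic partition of a finite set $A$ is a partition $A=A_1\sqcup A_2\sqcup\cdots\sqcup A_t$ into parts such that $|A_i|\le\frac12(|A_i|+\cdots+|A_t|)$ for all $i<t$ and $|A_t|=1$. -}

module Defs where

open import Data.Nat using (ℕ; suc; _+_; _*_; _∸_; _^_; _≤_; _<_; _/_)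
open import Data.Nat.Properties using (m^n≢0)
open import Data.Fin using (Fin; toℕ)
open import Data.Fin.Properties using () renaming (_≟_ to _≟ᶠ_)
open import Data.Fin.Subset using (Subset; _∉_; ∣_∣)
open import Data.Fin.Subset.Properties using (_∈?_)
open import Data.List using (List; length; filter; allFin)
open import Data.Product using (Σ; ∃; _×_; _,_)
open import Relation.Nullary using (Dec; ¬_; yes; no)
open import Relation.Nullary.Decidable using (_×-dec_; ¬?)
open import Data.Nat using (_≤?_)
open import Relation.Unary using (Pred; Decidable)
open import Relation.Binary.PropositionalEquality using (_≡_)
open import Level using (0ℓ)

#_ : ∀ {n} {P : Pred (Fin n) 0ℓ} → Decidable P → ℕ
#_ {n} P? = length (filter P? (allFin n))

-- A finite set A is modelled as Fin n; a partition of A into t parts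
-- A_1,...,A_t (indexed by Fin t, index 0 = A_1) is given by the map
-- ind : Fin n → Fin t sending a to i(a).

partSize : ∀ {n t} → (Fin n → Fin t) → Fin t → ℕ
partSize ind j = # (λ a → ind a ≟ᶠ j)

tailSize : ∀ {n t} → (Fin n → Fin t) → Fin t → ℕ
tailSize ind j = # (λ a → toℕ j ≤? toℕ (ind a))

IsPartition : ∀ {n t} → (Fin n → Fin t) → Set
IsPartition {n} {t} ind = ∀ (j : Fin t) → ∃ λ (a : Fin n) → ind a ≡ j

IsDyadic : ∀ {n t} → (Fin n → Fin t) → Set
IsDyadic {n} {t} ind =
  IsPartition ind
  × (1 ≤ t)
  × (∀ (j : Fin t) → suc (toℕ j) < t → 2 * partSize ind j ≤ tailSize ind j)
  × (∀ (j : Fin t) → suc (toℕ j) ≡ t → partSize ind j ≡ 1)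

data Colour : Set where
  L R : Colour

_≟ᶜ_ : (x y : Colour) → Dec (x ≡ y)
L ≟ᶜ L = yes _≡_.refl
L ≟ᶜ R = no (λ ())
R ≟ᶜ L = no (λ ())
R ≟ᶜ R = yes _≡_.refl

countOutside : ∀ {n t} → (Fin n → Fin t) → (Fin t → Colour) → Colour → Subset t → ℕ
countOutside ind β X I =
  # (λ a → (¬? (ind a ∈? I)) ×-dec (β (ind a) ≟ᶜ X))

floorDivPow2 : ℕ → ℕ → ℕ
floorDivPow2 m k = _/_ m (2 ^ k) {{m^n≢0 2 k}}

{-# OPTIONS --safe #-}
-- With p_j = |A_j|, dyadicity says p_j ≤ p_{j+1} + ⋯ + p_t, so deleting the first part of a
-- tail A_j ∪ ⋯ ∪ A_t at most halves it. By induction along the parts, deleting any set J of at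
-- most t − 1 parts keeps at least |A|/2^|J| elements (if only A_1 survives, use
-- |A| ≤ 2^(t−1) ≤ 2^(t−1)|A_1|). For I, K of size s − 1 every element outside I ∪ K is counted
-- for L outside I or for R outside K, so one of the two counts is at least |A|/2^(2s−1).
-- Subsets of [t] can be searched, so either L works for every I, or L fails for some I and
-- then R works for every K.
module Submission where

open import Defs
open import Data.Nat using (ℕ; _*_; _∸_; _≤_; _<_)
open import Data.Fin using (Fin)
open import Data.Fin.Subset using (Subset; ∣_∣)
open import Data.Product using (∃)
open import Relation.Binary.PropositionalEquality using (_≡_)

open import Level using (Level)
open import Function using (_∘_; _$_; _⇔_; mk⇔)
open import Data.Bool using (true; false; if_then_else_)
open import Data.Nat using (zero; suc; _+_; _^_; _⊔_; NonZero; z≤n; s≤s; s≤s⁻¹; _≤?_; _≟_; _/_)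
open import Data.Nat.Properties
open import Data.Nat.DivMod using (m*n/n≡m; /-monoˡ-≤)
open import Data.Nat.Tactic.RingSolver using (solve-∀)
open import Data.Fin using (zero; suc; toℕ; fromℕ; punchIn)
open import Data.Fin.Properties using (toℕ-fromℕ; punchInᵢ≢i) renaming (_≟_ to _≟ᶠ_)
open import Data.Fin.Subset using (_∪_; _∉_; inside; outside)
open import Data.Fin.Subset.Properties using (_∈?_; x∈p∪q⁺; anySubset?)
open import Data.List using (length; filter; tabulate)
open import Data.Vec using (_∷_; [])
open import Data.Vec.Functional using (Vector; tail)
open import Data.Product using (_×_; _,_)
open import Data.Sum as Sum using (_⊎_; inj₁; inj₂; [_,_]′)
open import Relation.Nullary using (Dec; yes; no; does; ¬_; contradiction)
open import Relation.Nullary.Decidable using (_×-dec_; ¬?; dec-true; dec-false; does-⇔; decidable-stable)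
open import Relation.Unary using (Pred; Decidable)
open import Relation.Binary.PropositionalEquality using (refl; sym; trans; cong; cong₂; subst; module ≡-Reasoning)
open import Algebra.Properties.Semiring.Sum +-*-semiring
  using (sum; sum-syntax; sum-cong-≗; sum-remove; sum-replicate-zero; ∑-comm; ∑-distrib-+; *-distribˡ-sum)

private
  variable
    a ℓ : Level
    A : Set a
    n t : ℕ

χ : {P : Set ℓ} → Dec P → ℕ
χ P? = if does P? then 1 else 0

χ-yes : {P : Set ℓ} (P? : Dec P) → P → χ P? ≡ 1
χ-yes P? p = cong (λ b → if b then 1 else 0) (dec-true P? p)

χ-no : {P : Set ℓ} (P? : Dec P) → ¬ P → χ P? ≡ 0
χ-no P? ¬p = cong (λ b → if b then 1 else 0) (dec-false P? ¬p)

χ-⇔ : {P Q : Set ℓ} → P ⇔ Q → (P? : Dec P) (Q? : Dec Q) → χ P? ≡ χ Q?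
χ-⇔ P⇔Q P? Q? = cong (λ b → if b then 1 else 0) (does-⇔ P⇔Q P? Q?)

χ-⊎ : {P Q R : Set ℓ} → (P → Q ⊎ R) → (P? : Dec P) (Q? : Dec Q) (R? : Dec R) → χ P? ≤ χ Q? + χ R?
χ-⊎ f (no _) Q? R? = z≤n
χ-⊎ f (yes p) Q? R? with f p
... | inj₁ q = subst (_≤ χ Q? + χ R?) (χ-yes Q? q) (m≤m+n (χ Q?) (χ R?))
... | inj₂ r = subst (_≤ χ Q? + χ R?) (χ-yes R? r) (m≤n+m (χ R?) (χ Q?))

length-filter-tabulate : {P : Pred A ℓ} (P? : Decidable P) (f : Fin n → A) →
  length (filter P? (tabulate f)) ≡ ∑[ i < n ] χ (P? (f i))
length-filter-tabulate {n = zero}  P? f = refl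
length-filter-tabulate {n = suc n} P? f with does (P? (f zero))
... | true  = cong suc (length-filter-tabulate P? (f ∘ suc))
... | false = length-filter-tabulate P? (f ∘ suc)

#≡∑χ : {P : Pred (Fin n) Level.zero} (P? : Decidable P) → # P? ≡ ∑[ a < n ] χ (P? a)
#≡∑χ P? = length-filter-tabulate P? (λ a → a)

∑-mono-≤ : {f g : Vector ℕ n} → (∀ i → f i ≤ g i) → sum f ≤ sum g
∑-mono-≤ {n = zero}  f≤g = z≤n
∑-mono-≤ {n = suc n} f≤g = +-mono-≤ (f≤g zero) (∑-mono-≤ (f≤g ∘ suc))

x≤∑x : (x : Vector ℕ n) (i : Fin n) → x i ≤ sum x
x≤∑x {n = suc n} x i = subst (x i ≤_) (sym (sum-remove {i = i} x)) (m≤m+n (x i) _)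

∑1≡n : ∀ n → ∑[ i < n ] 1 ≡ n
∑1≡n zero    = refl
∑1≡n (suc n) = cong suc (∑1≡n n)

∑-δ : (w : Vector ℕ t) (k : Fin t) → ∑[ j < t ] (w j * χ (k ≟ᶠ j)) ≡ w k
∑-δ {t = suc t} w k = begin
  ∑[ j < suc t ] (w j * χ (k ≟ᶠ j))                              ≡⟨ sum-remove {i = k} (λ j → w j * χ (k ≟ᶠ j)) ⟩
  w k * χ (k ≟ᶠ k) + ∑[ i < t ] (w (punchIn k i) * χ (k ≟ᶠ punchIn k i))
    ≡⟨ cong₂ _+_ (cong (w k *_) (χ-yes (k ≟ᶠ k) refl)) (sum-cong-≗ off-diagonal) ⟩
  w k * 1 + ∑[ i < t ] 0                                         ≡⟨ cong₂ _+_ (*-identityʳ (w k)) (sum-replicate-zero t) ⟩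
  w k + 0                                                        ≡⟨ +-identityʳ (w k) ⟩
  w k                                                            ∎
  where
  open ≡-Reasoning
  off-diagonal : ∀ i → w (punchIn k i) * χ (k ≟ᶠ punchIn k i) ≡ 0
  off-diagonal i = trans (cong (w (punchIn k i) *_) (χ-no (k ≟ᶠ punchIn k i) (punchInᵢ≢i k i ∘ sym)))
                         (*-zeroʳ (w (punchIn k i)))

∑-fibre : (ind : Fin n → Fin t) (w : Vector ℕ t) →
  ∑[ a < n ] w (ind a) ≡ ∑[ j < t ] (w j * partSize ind j)
∑-fibre {n = n} {t = t} ind w = begin
  ∑[ a < n ] w (ind a)                          ≡⟨ sum-cong-≗ {y = λ a → w (ind a)} (λ a → ∑-δ w (ind a)) ⟨
  ∑[ a < n ] ∑[ j < t ] (w j * χ (ind a ≟ᶠ j))  ≡⟨ ∑-comm (λ a j → w j * χ (ind a ≟ᶠ j)) ⟩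
  ∑[ j < t ] ∑[ a < n ] (w j * χ (ind a ≟ᶠ j))  ≡⟨ sum-cong-≗ (λ j → *-distribˡ-sum (w j) (λ a → χ (ind a ≟ᶠ j))) ⟨
  ∑[ j < t ] (w j * ∑[ a < n ] χ (ind a ≟ᶠ j))  ≡⟨ sum-cong-≗ (λ j → cong (w j *_) (#≡∑χ (λ a → ind a ≟ᶠ j))) ⟨
  ∑[ j < t ] (w j * partSize ind j)             ∎
  where open ≡-Reasoning

#∘≡∑ : (ind : Fin n → Fin t) {Q : Pred (Fin t) Level.zero} (Q? : Decidable Q) →
  # (Q? ∘ ind) ≡ ∑[ j < t ] (χ (Q? j) * partSize ind j)
#∘≡∑ ind Q? = trans (#≡∑χ (Q? ∘ ind)) (∑-fibre ind (χ ∘ Q?))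

n≡∑partSize : (ind : Fin n → Fin t) → n ≡ sum (partSize ind)
n≡∑partSize {n = n} ind = begin
  n                                ≡⟨ ∑1≡n n ⟨
  ∑[ a < n ] 1                     ≡⟨ ∑-fibre ind (λ _ → 1) ⟩
  ∑[ j < _ ] (1 * partSize ind j)  ≡⟨ sum-cong-≗ (λ j → *-identityˡ (partSize ind j)) ⟩
  sum (partSize ind)               ∎
  where open ≡-Reasoning

sumFrom : Vector ℕ t → ℕ → ℕ
sumFrom {t = t} p k = ∑[ i < t ] (χ (k ≤? toℕ i) * p i)

sumFrom-zero : (p : Vector ℕ t) → sumFrom p 0 ≡ sum p
sumFrom-zero p = sum-cong-≗ (λ i → trans (cong (_* p i) (χ-yes (0 ≤? toℕ i) z≤n)) (*-identityˡ (p i)))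

sumFrom-suc : (p : Vector ℕ (suc t)) (k : ℕ) → sumFrom p (suc k) ≡ sumFrom (tail p) k
sumFrom-suc p k = cong₂ _+_
  (cong (_* p zero) (χ-no (suc k ≤? 0) λ ()))
  (sum-cong-≗ λ i → cong (_* p (suc i)) (χ-⇔ (mk⇔ s≤s⁻¹ s≤s) (suc k ≤? suc (toℕ i)) (k ≤? toℕ i)))

tailSize≡sumFrom : (ind : Fin n → Fin t) (j : Fin t) → tailSize ind j ≡ sumFrom (partSize ind) (toℕ j)
tailSize≡sumFrom ind j = #∘≡∑ ind (λ i → toℕ j ≤? toℕ i)

partSize-pos : (ind : Fin n → Fin t) → IsPartition ind → ∀ j → 1 ≤ partSize ind j
partSize-pos ind onto j with onto j
... | a , inda≡j = begin
  1                          ≡⟨ χ-yes (ind a ≟ᶠ j) inda≡j ⟨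
  χ (ind a ≟ᶠ j)             ≤⟨ x≤∑x (λ a → χ (ind a ≟ᶠ j)) a ⟩
  ∑[ a < _ ] χ (ind a ≟ᶠ j)  ≡⟨ #≡∑χ (λ a → ind a ≟ᶠ j) ⟨
  partSize ind j             ∎
  where open ≤-Reasoning

IsDyadicSeq : Vector ℕ (suc t) → Set
IsDyadicSeq {t = zero}  p = p zero ≡ 1
IsDyadicSeq {t = suc t} p = 1 ≤ p zero × p zero ≤ sum (tail p) × IsDyadicSeq (tail p)

tails⇒isDyadicSeq : (p : Vector ℕ (suc t)) → (∀ j → 1 ≤ p j) → p (fromℕ t) ≡ 1 →
  (∀ j → suc (toℕ j) < suc t → 2 * p j ≤ sumFrom p (toℕ j)) → IsDyadicSeq p
tails⇒isDyadicSeq {t = zero}  p pos last halving = last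
tails⇒isDyadicSeq {t = suc t} p pos last halving =
  pos zero , head≤tail , tails⇒isDyadicSeq (tail p) (pos ∘ suc) last halving-tail
  where
  head≤tail : p zero ≤ sum (tail p)
  head≤tail = +-cancelˡ-≤ (p zero) _ _ (begin
    p zero + p zero     ≡⟨ cong (p zero +_) (+-identityʳ (p zero)) ⟨
    2 * p zero          ≤⟨ halving zero (s≤s (s≤s z≤n)) ⟩
    sumFrom p 0         ≡⟨ sumFrom-zero p ⟩
    sum p               ∎)
    where open ≤-Reasoning
  halving-tail : ∀ j → suc (toℕ j) < suc t → 2 * p (suc j) ≤ sumFrom (tail p) (toℕ j)
  halving-tail j h = subst (2 * p (suc j) ≤_) (sumFrom-suc p (toℕ j)) (halving (suc j) (s≤s h))

partSize-isDyadicSeq : (ind : Fin n → Fin (suc t)) → IsDyadic ind → IsDyadicSeq (partSize ind)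
partSize-isDyadicSeq {t = t} ind (onto , _ , halving , last) =
  tails⇒isDyadicSeq (partSize ind) (partSize-pos ind onto) (last (fromℕ t) (cong suc (toℕ-fromℕ t)))
    (λ j h → subst (2 * partSize ind j ≤_) (tailSize≡sumFrom ind j) (halving j h))

2*m*n≡m*n+m*n : ∀ m n → 2 * m * n ≡ m * n + m * n
2*m*n≡m*n+m*n = solve-∀

sum≤2^ : (p : Vector ℕ (suc t)) → IsDyadicSeq p → sum p ≤ 2 ^ t
sum≤2^ {t = zero}  p p₀≡1 = ≤-reflexive (trans (+-identityʳ (p zero)) p₀≡1)
sum≤2^ {t = suc t} p (_ , p₀≤∑ , dyadic) = begin
  p zero + sum (tail p)       ≤⟨ +-monoˡ-≤ (sum (tail p)) p₀≤∑ ⟩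
  sum (tail p) + sum (tail p) ≤⟨ +-mono-≤ ih ih ⟩
  2 ^ t + 2 ^ t               ≡⟨ cong (2 ^ t +_) (+-identityʳ (2 ^ t)) ⟨
  2 ^ suc t                   ∎
  where
  open ≤-Reasoning
  ih : sum (tail p) ≤ 2 ^ t
  ih = sum≤2^ (tail p) dyadic

weightOutside : Vector ℕ t → Subset t → ℕ
weightOutside {t = t} p J = ∑[ j < t ] (χ (¬? (j ∈? J)) * p j)

sum≤2^∣J∣*weightOutside : (p : Vector ℕ (suc t)) → IsDyadicSeq p →
  (J : Subset (suc t)) → ∣ J ∣ ≤ t → sum p ≤ 2 ^ ∣ J ∣ * weightOutside p J
sum≤2^∣J∣*weightOutside {t = zero} p _ (inside ∷ []) ()
sum≤2^∣J∣*weightOutside {t = zero} p _ (outside ∷ []) _ =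
  ≤-reflexive (cong (_+ 0) (trans (sym (*-identityˡ (p zero))) (sym (+-identityʳ (1 * p zero)))))
sum≤2^∣J∣*weightOutside {t = suc t} p (_ , p₀≤∑ , dyadic) (inside ∷ J) (s≤s ∣J∣≤t) = begin
  p zero + sum (tail p)                        ≤⟨ +-monoˡ-≤ (sum (tail p)) p₀≤∑ ⟩
  sum (tail p) + sum (tail p)                  ≤⟨ +-mono-≤ ih ih ⟩
  2 ^ ∣ J ∣ * W + 2 ^ ∣ J ∣ * W                ≡⟨ 2*m*n≡m*n+m*n (2 ^ ∣ J ∣) W ⟨
  2 ^ suc ∣ J ∣ * W                            ∎
  where
  open ≤-Reasoning
  W : ℕ
  W = weightOutside (tail p) J
  ih : sum (tail p) ≤ 2 ^ ∣ J ∣ * W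
  ih = sum≤2^∣J∣*weightOutside (tail p) dyadic J ∣J∣≤t
sum≤2^∣J∣*weightOutside {t = suc t} p (1≤p₀ , p₀≤∑ , dyadic) (outside ∷ J) ∣J∣≤1+t
  with m≤n⇒m<n∨m≡n ∣J∣≤1+t
... | inj₁ (s≤s ∣J∣≤t) = begin
  p zero + sum (tail p)                        ≤⟨ +-mono-≤ (m≤n*m (p zero) (2 ^ ∣ J ∣) {{m^n≢0 2 ∣ J ∣}}) ih ⟩
  2 ^ ∣ J ∣ * p zero + 2 ^ ∣ J ∣ * W           ≡⟨ *-distribˡ-+ (2 ^ ∣ J ∣) (p zero) W ⟨
  2 ^ ∣ J ∣ * (p zero + W)                     ≡⟨ cong (λ x → 2 ^ ∣ J ∣ * (x + W)) (*-identityˡ (p zero)) ⟨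
  2 ^ ∣ J ∣ * (1 * p zero + W)                 ∎
  where
  open ≤-Reasoning
  W : ℕ
  W = weightOutside (tail p) J
  ih : sum (tail p) ≤ 2 ^ ∣ J ∣ * W
  ih = sum≤2^∣J∣*weightOutside (tail p) dyadic J ∣J∣≤t
... | inj₂ ∣J∣≡1+t rewrite ∣J∣≡1+t = begin
  p zero + sum (tail p)                        ≤⟨ +-mono-≤ (m≤n*m (p zero) (2 ^ t) {{m^n≢0 2 t}}) ∑≤2^t*p₀ ⟩
  2 ^ t * p zero + 2 ^ t * p zero              ≡⟨ 2*m*n≡m*n+m*n (2 ^ t) (p zero) ⟨
  2 ^ suc t * p zero                           ≤⟨ *-monoʳ-≤ (2 ^ suc t) (m≤m+n (p zero) W) ⟩
  2 ^ suc t * (p zero + W)                     ≡⟨ cong (λ x → 2 ^ suc t * (x + W)) (*-identityˡ (p zero)) ⟨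
  2 ^ suc t * (1 * p zero + W)                 ∎
  where
  open ≤-Reasoning
  W : ℕ
  W = weightOutside (tail p) J
  ∑≤2^t*p₀ : sum (tail p) ≤ 2 ^ t * p zero
  ∑≤2^t*p₀ = ≤-trans (sum≤2^ (tail p) dyadic)
                     (≤-trans (≤-reflexive (sym (*-identityʳ (2 ^ t)))) (*-monoʳ-≤ (2 ^ t) 1≤p₀))

∣p∪q∣≤∣p∣+∣q∣ : (p q : Subset n) → ∣ p ∪ q ∣ ≤ ∣ p ∣ + ∣ q ∣
∣p∪q∣≤∣p∣+∣q∣ []            []            = z≤n
∣p∪q∣≤∣p∣+∣q∣ (inside ∷ p)  (inside ∷ q)  = s≤s (≤-trans (∣p∪q∣≤∣p∣+∣q∣ p q) (+-monoʳ-≤ ∣ p ∣ (n≤1+n ∣ q ∣)))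
∣p∪q∣≤∣p∣+∣q∣ (inside ∷ p)  (outside ∷ q) = s≤s (∣p∪q∣≤∣p∣+∣q∣ p q)
∣p∪q∣≤∣p∣+∣q∣ (outside ∷ p) (inside ∷ q)  = subst (suc ∣ p ∪ q ∣ ≤_) (sym (+-suc ∣ p ∣ ∣ q ∣)) (s≤s (∣p∪q∣≤∣p∣+∣q∣ p q))
∣p∪q∣≤∣p∣+∣q∣ (outside ∷ p) (outside ∷ q) = ∣p∪q∣≤∣p∣+∣q∣ p q

∀∀⊎⇒∀⊎∀ : {S P Q : Pred (Subset n) ℓ} → Decidable S → Decidable P →
  (∀ {I K} → S I → S K → P I ⊎ Q K) → (∀ I → S I → P I) ⊎ (∀ K → S K → Q K)
∀∀⊎⇒∀⊎∀ S? P? dichotomy with anySubset? (λ I → S? I ×-dec ¬? (P? I))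
... | yes (I , sI , ¬pI) = inj₂ λ K sK → [ (λ pI → contradiction pI ¬pI) , (λ qK → qK) ]′ (dichotomy sI sK)
... | no ∄I = inj₁ λ I sI → decidable-stable (P? I) λ ¬pI → ∄I (I , sI , ¬pI)

colour-cases : ∀ c → c ≡ L ⊎ c ≡ R
colour-cases L = inj₁ refl
colour-cases R = inj₂ refl

weightOutside-∪ : (p : Vector ℕ t) (β : Fin t → Colour) (I K : Subset t) →
  weightOutside p (I ∪ K) ≤ ∑[ j < t ] (χ (¬? (j ∈? I) ×-dec (β j ≟ᶜ L)) * p j)
                          + ∑[ j < t ] (χ (¬? (j ∈? K) ×-dec (β j ≟ᶜ R)) * p j)
weightOutside-∪ p β I K = begin
  weightOutside p (I ∪ K)                       ≤⟨ ∑-mono-≤ (λ j → *-monoˡ-≤ (p j) (χ-cover j)) ⟩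
  ∑[ j < _ ] ((χL j + χR j) * p j)              ≡⟨ sum-cong-≗ (λ j → *-distribʳ-+ (p j) (χL j) (χR j)) ⟩
  ∑[ j < _ ] (χL j * p j + χR j * p j)          ≡⟨ ∑-distrib-+ (λ j → χL j * p j) (λ j → χR j * p j) ⟩
  ∑[ j < _ ] (χL j * p j) + ∑[ j < _ ] (χR j * p j) ∎
  where
  open ≤-Reasoning
  χL χR : Fin _ → ℕ
  χL j = χ (¬? (j ∈? I) ×-dec (β j ≟ᶜ L))
  χR j = χ (¬? (j ∈? K) ×-dec (β j ≟ᶜ R))
  coloured : ∀ {j} → j ∉ I ∪ K → (j ∉ I × β j ≡ L) ⊎ (j ∉ K × β j ≡ R)
  coloured {j} j∉I∪K =
    Sum.map (j∉I∪K ∘ x∈p∪q⁺ ∘ inj₁ ,_) (j∉I∪K ∘ x∈p∪q⁺ ∘ inj₂ ,_) (colour-cases (β j))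
  χ-cover : ∀ j → χ (¬? (j ∈? I ∪ K)) ≤ χL j + χR j
  χ-cover j = χ-⊎ coloured (¬? (j ∈? I ∪ K)) (¬? (j ∈? I) ×-dec (β j ≟ᶜ L)) (¬? (j ∈? K) ×-dec (β j ≟ᶜ R))

floorDivPow2-suc≤⊎ : ∀ e {m x y} → m ≤ 2 ^ e * (x + y) →
  floorDivPow2 m (suc e) ≤ x ⊎ floorDivPow2 m (suc e) ≤ y
floorDivPow2-suc≤⊎ e {m} {x} {y} m≤ =
  Sum.map (λ eq → subst (_ ≤_) eq ≤x⊔y) (λ eq → subst (_ ≤_) eq ≤x⊔y) (⊔-sel x y)
  where
  open ≤-Reasoning
  instance
    2^[1+e]≢0 : NonZero (2 ^ suc e)
    2^[1+e]≢0 = m^n≢0 2 (suc e)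
  ≤x⊔y : floorDivPow2 m (suc e) ≤ x ⊔ y
  ≤x⊔y = begin
    floorDivPow2 m (suc e)                        ≤⟨ /-monoˡ-≤ (2 ^ suc e) (begin
      m                                             ≤⟨ m≤ ⟩
      2 ^ e * (x + y)                               ≤⟨ *-monoʳ-≤ (2 ^ e) (+-mono-≤ (m≤m⊔n x y) (m≤n⊔m x y)) ⟩
      2 ^ e * ((x ⊔ y) + (x ⊔ y))                   ≡⟨ *-distribˡ-+ (2 ^ e) (x ⊔ y) (x ⊔ y) ⟩
      2 ^ e * (x ⊔ y) + 2 ^ e * (x ⊔ y)             ≡⟨ 2*m*n≡m*n+m*n (2 ^ e) (x ⊔ y) ⟨
      2 ^ suc e * (x ⊔ y)                           ≡⟨ *-comm (2 ^ suc e) (x ⊔ y) ⟩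
      (x ⊔ y) * 2 ^ suc e                           ∎) ⟩
    (x ⊔ y) * 2 ^ suc e / 2 ^ suc e               ≡⟨ m*n/n≡m (x ⊔ y) (2 ^ suc e) ⟩
    x ⊔ y                                         ∎

colour-dichotomy : (ind : Fin n → Fin (suc t)) → IsDyadic ind → ∀ {s} → 2 * suc s < suc t →
  (β : Fin (suc t) → Colour) {I K : Subset (suc t)} → ∣ I ∣ ≡ s → ∣ K ∣ ≡ s →
  floorDivPow2 n (2 * suc s ∸ 1) ≤ countOutside ind β L I
    ⊎ floorDivPow2 n (2 * suc s ∸ 1) ≤ countOutside ind β R K
colour-dichotomy {n = n} {t = t} ind dyadic {s} 2[1+s]<1+t β {I} {K} ∣I∣≡s ∣K∣≡s =
  subst (λ e → floorDivPow2 n e ≤ countOutside ind β L I ⊎ floorDivPow2 n e ≤ countOutside ind β R K)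
        (sym (cong (_∸ 1) (*-suc 2 s))) $
  floorDivPow2-suc≤⊎ (2 * s) (begin
    n                                                   ≡⟨ n≡∑partSize ind ⟩
    sum p                                               ≤⟨ sum≤2^∣J∣*weightOutside p dyadicSeq (I ∪ K) ∣I∪K∣≤t ⟩
    2 ^ ∣ I ∪ K ∣ * weightOutside p (I ∪ K)             ≤⟨ *-mono-≤ (^-monoʳ-≤ 2 ∣I∪K∣≤2s) (weightOutside-∪ p β I K) ⟩
    2 ^ (2 * s) * (∑L + ∑R)                             ≡⟨ cong (2 ^ (2 * s) *_) (cong₂ _+_ (#∘≡∑ ind χL?) (#∘≡∑ ind χR?)) ⟨
    2 ^ (2 * s) * (countOutside ind β L I + countOutside ind β R K) ∎)
  where
  open ≤-Reasoning
  p : Vector ℕ (suc t)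
  p = partSize ind
  dyadicSeq : IsDyadicSeq p
  dyadicSeq = partSize-isDyadicSeq ind dyadic
  χL? χR? : Decidable _
  χL? j = ¬? (j ∈? I) ×-dec (β j ≟ᶜ L)
  χR? j = ¬? (j ∈? K) ×-dec (β j ≟ᶜ R)
  ∑L ∑R : ℕ
  ∑L = ∑[ j < _ ] (χ (χL? j) * p j)
  ∑R = ∑[ j < _ ] (χ (χR? j) * p j)
  ∣I∪K∣≤2s : ∣ I ∪ K ∣ ≤ 2 * s
  ∣I∪K∣≤2s = ≤-trans (∣p∪q∣≤∣p∣+∣q∣ I K)
                     (≤-reflexive (trans (cong₂ _+_ ∣I∣≡s ∣K∣≡s) (cong (s +_) (sym (+-identityʳ s)))))
  ∣I∪K∣≤t : ∣ I ∪ K ∣ ≤ t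
  ∣I∪K∣≤t = ≤-trans ∣I∪K∣≤2s (m+n≤o⇒n≤o 2 (subst (_≤ t) (*-suc 2 s) (s≤s⁻¹ 2[1+s]<1+t)))

lemma3p6 : ∀ (n t : ℕ) (ind : Fin n → Fin t) → IsDyadic ind →
    ∀ (s : ℕ) → 1 ≤ s → 2 * s < t → ∀ (β : Fin t → Colour) →
    ∃ λ (X : Colour) → ∀ (I : Subset t) → ∣ I ∣ ≡ s ∸ 1 →
      floorDivPow2 n (2 * s ∸ 1) ≤ countOutside ind β X I
lemma3p6 n zero    ind dyadic s       _  ()
lemma3p6 n (suc t) ind dyadic zero    () _
lemma3p6 n (suc t) ind dyadic (suc s) _  2s<t β =
  [ (L ,_) , (R ,_) ]′ (∀∀⊎⇒∀⊎∀ (λ I → ∣ I ∣ ≟ s)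
                                 (λ I → floorDivPow2 n (2 * suc s ∸ 1) ≤? countOutside ind β L I)
                                 (colour-dichotomy ind dyadic 2s<t β))
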